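{- Let $n\ge 2$, $1\le i\le n-1$ and $a_i$ a positive integer. A point of $U$ is a vertex of $P_{a_i\omega_i}$ if and only if it has the form $a_i\chi_A$, where $\chi_A$ is the indicator function of a $\preceq$-antichain $A\subset Q_i$.
   Context: $U=\mathbb R^{\binom n2}$ with coordinates $x_{k,l}$, $1\le k<l\le n$. A Dyck path is a sequence $d=((i_1,j_1),\ldots,(i_N,j_N))$ of pairs with $1\le i_k<j_k\le n$, $j_1-i_1=j_N-i_N=1$, and each $(i_{k+1},j_{k+1})$ equal to $(i_k+1,j_k)$ or $(i_k,j_k+1)$. $P_{a_i\omega_i}=\{x\in U:x\ge0,\ \sum_{(k,l)\in d}x_{k,l}\le M(d)\ \forall d\}$, where $M(d)=a_i$ if $i_1\le i\le i_N$ and $M(d)=0$ otherwise. Pairs are ordered by $(k_1,l_1)\preceq(k_2,l_2)$ iff $k_1\le k_2$ and $l_1\le l_2$. $Q_i=\{(k,l):1\le k\le i,\ i+1\le l\le n\}$.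
   Formalization: Points of U have rational rather than real coordinates, and being a vertex of $P_{a_i\omega_i}$ is tested only against rational points and rational convex combinations. -}

module Defs where

open import Data.Nat as ℕ using (ℕ; zero; suc; _≤ᵇ_)
open import Data.Integer using (+_)
open import Data.Rational using (ℚ; 0ℚ; 1ℚ; _+_; _*_; _-_; _/_; _≤_; _<_)
open import Data.Bool using (Bool; true; false; if_then_else_; _∧_)
open import Data.List using (List; []; _∷_)
open import Data.List.Relation.Unary.All using (All)
open import Data.Product using (_×_; _,_; proj₁; proj₂; Σ; ∃)
open import Data.Sum using (_⊎_)
open import Relation.Binary.PropositionalEquality using (_≡_)

toℚ : ℕ → ℚ
toℚ a = (+ a) / 1

-- A point of U = ℝ^(n choose 2) (here with rational coordinates):
-- a function on index pairs; only the values x k l with 1 ≤ k < l ≤ n matter.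
Point : Set
Point = ℕ → ℕ → ℚ

Valid : ℕ → ℕ × ℕ → Set
Valid n (k , l) = (1 ℕ.≤ k) × (k ℕ.< l) × (l ℕ.≤ n)

_≈[_]_ : Point → ℕ → Point → Set
x ≈[ n ] y = ∀ k l → Valid n (k , l) → x k l ≡ y k l

-- Paths: lists given as first element p and remaining elements ps.
lastOf : ℕ × ℕ → List (ℕ × ℕ) → ℕ × ℕ
lastOf p []       = p
lastOf p (q ∷ qs) = lastOf q qs

Step : ℕ × ℕ → ℕ × ℕ → Set
Step (i , j) (i' , j') = (i' ≡ suc i × j' ≡ j) ⊎ (i' ≡ i × j' ≡ suc j)

Chain : ℕ × ℕ → List (ℕ × ℕ) → Set
Chain p []       = Data.Unit.⊤ where import Data.Unit
Chain p (q ∷ qs) = Step p q × Chain q qs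

Diag : ℕ × ℕ → Set
Diag (i , j) = j ≡ suc i

IsDyck : ℕ → ℕ × ℕ → List (ℕ × ℕ) → Set
IsDyck n p ps = All (Valid n) (p ∷ ps) × Chain p ps × Diag p × Diag (lastOf p ps)

pathSum : Point → List (ℕ × ℕ) → ℚ
pathSum x []             = 0ℚ
pathSum x ((k , l) ∷ qs) = x k l + pathSum x qs

M : ℕ → ℕ → ℕ × ℕ → List (ℕ × ℕ) → ℚ
M i a p ps =
  if (proj₁ p ≤ᵇ i) ∧ (i ≤ᵇ proj₁ (lastOf p ps)) then toℚ a else 0ℚ

InP : ℕ → ℕ → ℕ → Point → Set
InP n i a x =
  (∀ k l → Valid n (k , l) → 0ℚ ≤ x k l) ×
  (∀ p ps → IsDyck n p ps → pathSum x (p ∷ ps) ≤ M i a p ps)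

IsVertex : ℕ → ℕ → ℕ → Point → Set
IsVertex n i a x =
  InP n i a x ×
  (∀ y z t → InP n i a y → InP n i a z → 0ℚ < t → t < 1ℚ →
     x ≈[ n ] (λ k l → t * y k l + (1ℚ - t) * z k l) →
     y ≈[ n ] z)

InQ : ℕ → ℕ → ℕ × ℕ → Set
InQ n i (k , l) = (1 ℕ.≤ k) × (k ℕ.≤ i) × (suc i ℕ.≤ l) × (l ℕ.≤ n)

_⪯_ : ℕ × ℕ → ℕ × ℕ → Set
(k₁ , l₁) ⪯ (k₂ , l₂) = (k₁ ℕ.≤ k₂) × (l₁ ℕ.≤ l₂)

Subset : Set
Subset = ℕ → ℕ → Bool

_∈ₛ_ : ℕ × ℕ → Subset → Set
(k , l) ∈ₛ A = A k l ≡ true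

SubsetOfQ : ℕ → ℕ → Subset → Set
SubsetOfQ n i A = ∀ p → p ∈ₛ A → InQ n i p

Antichain : Subset → Set
Antichain A = ∀ p q → p ∈ₛ A → q ∈ₛ A → p ⪯ q → p ≡ q

χ : Subset → Point
χ A k l = if A k l then 1ℚ else 0ℚ

{-# OPTIONS --safe #-}

-- Every y ∈ P satisfies 0 ≤ y ≤ a and vanishes off Q_i, as one sees from a single Dyck path
-- through each coordinate. A Dyck path is a ⪯-chain, so it meets an antichain A at most once;
-- hence aχ_A ∈ P, and as it only takes the extreme values 0 and a of [0 , a] it is a vertex.
-- Conversely, let A be the set of ⪯-minimal points of the support of a vertex x. For small t > 0
-- the point z = (x - t·aχ_A)/(1 - t) is still in P: paths through A lose t·a, and a path avoiding A
-- has slack, because its first positive entry is not minimal, so a heaviest path from the diagonal to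
-- that entry is strictly heavier than the initial segment it replaces. As x = t·aχ_A + (1 - t)·z and
-- x is a vertex, x = aχ_A.
module Submission where

open import Defs

-- The imports are local to this block so that the final statement can read _≤_ as the order on ℕ.
module _ where
  open import Data.Bool using (true; false; if_then_else_; _∧_)
  open import Data.Bool.Properties as Bool using (T-≡; T-∧)
  open import Data.List using (List; []; _∷_)
  open import Data.List.Relation.Unary.All as All using (All; []; _∷_)
  open import Data.List.Relation.Unary.Any using (Any; here; there)
  open import Data.Nat as ℕ using (ℕ; zero; suc; z≤n; s≤s)
  import Data.Nat.Properties as ℕ
  open import Data.Product using (Σ; Σ-syntax; ∃-syntax; _×_; _,_; proj₁; proj₂)
  open import Data.Product.Properties using (≡-dec)
  open import Data.Rational as ℚ
    using (ℚ; 0ℚ; 1ℚ; ½; _+_; _*_; _-_; -_; _≤_; _<_; _⊓_; _⊔_; 1/_; positive; nonNegative; >-nonZero)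
  import Data.Rational.Properties as ℚ
  open import Algebra.Properties.Group ℚ.+-0-group using (x∙y⁻¹≈ε⇒x≈y)
  open import Data.Rational.Solver using (module +-*-Solver)
  open import Data.Sum using (_⊎_; inj₁; inj₂)
  open import Function.Base using (_∘_)
  open import Function.Bundles using (Equivalence)
  open import Relation.Nullary using (¬_; Dec; yes; no; does; proof; contradiction)
  open import Relation.Nullary.Reflects using (Reflects; invert)
  open import Relation.Nullary.Decidable using (dec-true; dec-false; toWitness; _×-dec_)
  open import Relation.Binary.PropositionalEquality
    using (_≡_; _≢_; refl; sym; trans; cong; cong₂; subst; module ≡-Reasoning)
  open +-*-Solver using (solve; _:+_; _:-_; _:*_; _:=_; con)

  0≤toℚ : ∀ a → 0ℚ ≤ toℚ a
  0≤toℚ a = ℚ.nonNegative⁻¹ _ {{ℚ.normalize-nonNeg a 1}}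

  0<toℚ : ∀ {a} → 1 ℕ.≤ a → 0ℚ < toℚ a
  0<toℚ {suc a} _ = ℚ.positive⁻¹ _ {{ℚ.normalize-pos (suc a) 1}}

  0<1 : 0ℚ < 1ℚ
  0<1 = ℚ.positive⁻¹ 1ℚ

  p≤q⇒0≤q-p : ∀ {p q} → p ≤ q → 0ℚ ≤ q - p
  p≤q⇒0≤q-p {p} {q} p≤q = subst (_≤ q - p) (ℚ.+-inverseʳ p) (ℚ.+-monoˡ-≤ (- p) p≤q)

  p<q⇒0<q-p : ∀ {p q} → p < q → 0ℚ < q - p
  p<q⇒0<q-p {p} {q} p<q = subst (_< q - p) (ℚ.+-inverseʳ p) (ℚ.+-monoˡ-< (- p) p<q)

  p≤p+q : ∀ {p q} → 0ℚ ≤ q → p ≤ p + q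
  p≤p+q {p} {q} 0≤q = subst (_≤ p + q) (ℚ.+-identityʳ p) (ℚ.+-monoʳ-≤ p 0≤q)

  p≤q+p : ∀ {p q} → 0ℚ ≤ q → p ≤ q + p
  p≤q+p {p} {q} 0≤q = subst (_≤ q + p) (ℚ.+-identityˡ p) (ℚ.+-monoˡ-≤ p 0≤q)

  p-q≤p : ∀ {p q} → 0ℚ ≤ q → p - q ≤ p
  p-q≤p {p} {q} 0≤q = subst (p - q ≤_) (ℚ.+-identityʳ p) (ℚ.+-monoʳ-≤ p (ℚ.neg-antimono-≤ 0≤q))

  p+q≤r⇒p≤r-q : ∀ {p q r} → p + q ≤ r → p ≤ r - q
  p+q≤r⇒p≤r-q {p} {q} {r} p+q≤r =
    subst (_≤ r - q) (solve 2 (λ p q → (p :+ q) :- q := p) refl p q) (ℚ.+-monoˡ-≤ (- q) p+q≤r)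

  p+q≤p⇒q≤0 : ∀ {p q} → p + q ≤ p → q ≤ 0ℚ
  p+q≤p⇒q≤0 {p} {q} p+q≤p =
    subst (q ≤_) (ℚ.+-inverseʳ p) (p+q≤r⇒p≤r-q (subst (_≤ p) (ℚ.+-comm p q) p+q≤p))

  nonneg*nonneg : ∀ {p q} → 0ℚ ≤ p → 0ℚ ≤ q → 0ℚ ≤ p * q
  nonneg*nonneg {p} {q} 0≤p 0≤q =
    ℚ.nonNegative⁻¹ (p * q) {{ℚ.nonNeg*nonNeg⇒nonNeg p {{nonNegative 0≤p}} q {{nonNegative 0≤q}}}}

  pos⊓pos : ∀ {p q} → 0ℚ < p → 0ℚ < q → 0ℚ < p ⊓ q
  pos⊓pos {p} {q} 0<p 0<q with ℚ.⊓-sel p q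
  ... | inj₁ p⊓q≡p = subst (0ℚ <_) (sym p⊓q≡p) 0<p
  ... | inj₂ p⊓q≡q = subst (0ℚ <_) (sym p⊓q≡q) 0<q

  convex-zero : ∀ {t u v} → 0ℚ < t → t < 1ℚ → 0ℚ ≤ u → 0ℚ ≤ v →
    t * u + (1ℚ - t) * v ≡ 0ℚ → u ≡ 0ℚ × v ≡ 0ℚ
  convex-zero {t} {u} {v} 0<t t<1 0≤u 0≤v sum≡0 =
    vanishes t 0<t 0≤u tu≤0 , vanishes (1ℚ - t) 0<1-t 0≤v sv≤0
    where
    0<1-t = p<q⇒0<q-p t<1
    tu≤0 : t * u ≤ 0ℚ
    tu≤0 = subst (t * u ≤_) sum≡0 (p≤p+q (nonneg*nonneg (ℚ.<⇒≤ 0<1-t) 0≤v))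
    sv≤0 : (1ℚ - t) * v ≤ 0ℚ
    sv≤0 = subst ((1ℚ - t) * v ≤_) sum≡0 (p≤q+p (nonneg*nonneg (ℚ.<⇒≤ 0<t) 0≤u))
    vanishes : ∀ r {p} → 0ℚ < r → 0ℚ ≤ p → r * p ≤ 0ℚ → p ≡ 0ℚ
    vanishes r {p} 0<r 0≤p rp≤0 =
      ℚ.≤-antisym (ℚ.*-cancelˡ-≤-pos r {{positive 0<r}} (subst (r * p ≤_) (sym (ℚ.*-zeroʳ r)) rp≤0)) 0≤p

  convex-endpoint : ∀ {t y z α} → 0ℚ < t → t < 1ℚ → 0ℚ ≤ y → y ≤ α → 0ℚ ≤ z → z ≤ α →
    (t * y + (1ℚ - t) * z ≡ 0ℚ ⊎ t * y + (1ℚ - t) * z ≡ α) → y ≡ z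
  convex-endpoint 0<t t<1 0≤y _ 0≤z _ (inj₁ at0) =
    let (y≡0 , z≡0) = convex-zero 0<t t<1 0≤y 0≤z at0 in trans y≡0 (sym z≡0)
  convex-endpoint {t} {y} {z} {α} 0<t t<1 _ y≤α _ z≤α (inj₂ atα) =
    let (α-y≡0 , α-z≡0) = convex-zero 0<t t<1 (p≤q⇒0≤q-p y≤α) (p≤q⇒0≤q-p z≤α) reflected
    in trans (sym (x∙y⁻¹≈ε⇒x≈y α y α-y≡0)) (x∙y⁻¹≈ε⇒x≈y α z α-z≡0)
    where
    reflected : t * (α - y) + (1ℚ - t) * (α - z) ≡ 0ℚ
    reflected = begin
      t * (α - y) + (1ℚ - t) * (α - z)  ≡⟨ solve 4 (λ t y z α → t :* (α :- y) :+ (con 1ℚ :- t) :* (α :- z)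
                                                  := α :- (t :* y :+ (con 1ℚ :- t) :* z)) refl t y z α ⟩
      α - (t * y + (1ℚ - t) * z)        ≡⟨ cong (λ w → α - w) atα ⟩
      α - α                             ≡⟨ ℚ.+-inverseʳ α ⟩
      0ℚ                                ∎
      where open ≡-Reasoning

  _≺_ : ℕ × ℕ → ℕ × ℕ → Set
  (k , l) ≺ (k′ , l′) = (k , l) ⪯ (k′ , l′) × k ℕ.+ l ℕ.< k′ ℕ.+ l′

  _∉ₛ_ : ℕ × ℕ → Subset → Set
  p ∉ₛ A = ¬ p ∈ₛ A

  ⪯-refl : ∀ {p} → p ⪯ p
  ⪯-refl = ℕ.≤-refl , ℕ.≤-refl

  ⪯-trans : ∀ {p q r} → p ⪯ q → q ⪯ r → p ⪯ r
  ⪯-trans (k≤ , l≤) (k≤′ , l≤′) = ℕ.≤-trans k≤ k≤′ , ℕ.≤-trans l≤ l≤′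

  ≺-trans : ∀ {p q r} → p ≺ q → q ≺ r → p ≺ r
  ≺-trans (p⪯q , p<q) (q⪯r , q<r) = ⪯-trans p⪯q q⪯r , ℕ.<-trans p<q q<r

  ≺⇒≢ : ∀ {p q} → p ≺ q → p ≢ q
  ≺⇒≢ (_ , p<q) refl = ℕ.<-irrefl refl p<q

  Step⇒≺ : ∀ {p q} → Step p q → p ≺ q
  Step⇒≺ {k , l} (inj₁ (refl , refl)) = (ℕ.n≤1+n k , ℕ.≤-refl) , ℕ.≤-refl
  Step⇒≺ {k , l} (inj₂ (refl , refl)) = (ℕ.≤-refl , ℕ.n≤1+n l) , ℕ.≤-reflexive (sym (ℕ.+-suc k l))

  Chain⇒≺ : ∀ {p ps} → Chain p ps → All (p ≺_) ps
  Chain⇒≺ {ps = []} _ = []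
  Chain⇒≺ {ps = _ ∷ _} (s , ch) = Step⇒≺ s ∷ All.map (≺-trans (Step⇒≺ s)) (Chain⇒≺ ch)

  Chain⇒first⪯ : ∀ {p ps} → Chain p ps → All (p ⪯_) (p ∷ ps)
  Chain⇒first⪯ ch = ⪯-refl ∷ All.map proj₁ (Chain⇒≺ ch)

  Chain⇒⪯last : ∀ {p ps} → Chain p ps → All (_⪯ lastOf p ps) (p ∷ ps)
  Chain⇒⪯last {ps = []} _ = ⪯-refl ∷ []
  Chain⇒⪯last {ps = _ ∷ _} (s , ch) =
    let q⪯last = Chain⇒⪯last ch in ⪯-trans (proj₁ (Step⇒≺ s)) (All.head q⪯last) ∷ q⪯last

  Chain-leaves-antichain : ∀ {A p ps} → Antichain A → Chain p ps → p ∈ₛ A → All (_∉ₛ A) ps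
  Chain-leaves-antichain {p = p} anti ch p∈A =
    All.map (λ {q} p≺q q∈A → ≺⇒≢ p≺q (anti p q p∈A q∈A (proj₁ p≺q))) (Chain⇒≺ ch)

  ⪯-Diag : ∀ {c d} → c ⪯ d → Diag d → proj₂ c ℕ.≤ suc (proj₁ d)
  ⪯-Diag (_ , c≤d) refl = c≤d

  _∈ₛ?_ : ∀ p A → Dec (p ∈ₛ A)
  (k , l) ∈ₛ? A = A k l Bool.≟ true

  InQ⇒Valid : ∀ {n i p} → InQ n i p → Valid n p
  InQ⇒Valid (1≤k , k≤i , i<l , l≤n) = 1≤k , ℕ.≤-<-trans k≤i i<l , l≤n

  Nonneg : ℕ → Point → Set
  Nonneg n x = ∀ k l → Valid n (k , l) → 0ℚ ≤ x k l

  scaledχ : ℕ → Subset → Point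
  scaledχ a A k l = toℚ a * χ A k l

  χ-∈ : ∀ {A k l} → (k , l) ∈ₛ A → χ A k l ≡ 1ℚ
  χ-∈ k∈A rewrite k∈A = refl

  χ-∉ : ∀ {A k l} → (k , l) ∉ₛ A → χ A k l ≡ 0ℚ
  χ-∉ {A} {k} {l} k∉A with A k l
  ... | true = contradiction refl k∉A
  ... | false = refl

  scaledχ-∈ : ∀ {a A k l} → (k , l) ∈ₛ A → scaledχ a A k l ≡ toℚ a
  scaledχ-∈ {a} {A} k,l∈A = trans (cong (toℚ a *_) (χ-∈ {A} k,l∈A)) (ℚ.*-identityʳ (toℚ a))

  scaledχ-∉ : ∀ {a A k l} → (k , l) ∉ₛ A → scaledχ a A k l ≡ 0ℚ
  scaledχ-∉ {a} {A} k,l∉A = trans (cong (toℚ a *_) (χ-∉ {A} k,l∉A)) (ℚ.*-zeroʳ (toℚ a))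

  0≤χ : ∀ A k l → 0ℚ ≤ χ A k l
  0≤χ A k l with A k l
  ... | true = ℚ.<⇒≤ 0<1
  ... | false = ℚ.≤-refl

  pathSum-cong : ∀ {n x y L} → All (Valid n) L → x ≈[ n ] y → pathSum x L ≡ pathSum y L
  pathSum-cong [] _ = refl
  pathSum-cong {L = (k , l) ∷ _} (v ∷ vs) x≈y = cong₂ _+_ (x≈y k l v) (pathSum-cong vs x≈y)

  pathSum-nonneg : ∀ {n x L} → Nonneg n x → All (Valid n) L → 0ℚ ≤ pathSum x L
  pathSum-nonneg _ [] = ℚ.≤-refl
  pathSum-nonneg {L = (k , l) ∷ _} x≥0 (v ∷ vs) = ℚ.+-mono-≤ (x≥0 k l v) (pathSum-nonneg x≥0 vs)

  pathSum-scale : ∀ c x L → pathSum (λ k l → c * x k l) L ≡ c * pathSum x L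
  pathSum-scale c x [] = sym (ℚ.*-zeroʳ c)
  pathSum-scale c x ((k , l) ∷ L) =
    trans (cong (c * x k l +_) (pathSum-scale c x L)) (sym (ℚ.*-distribˡ-+ c (x k l) (pathSum x L)))

  pathSum-sub : ∀ x y L → pathSum (λ k l → x k l - y k l) L ≡ pathSum x L - pathSum y L
  pathSum-sub x y [] = refl
  pathSum-sub x y ((k , l) ∷ L) =
    trans (cong (x k l - y k l +_) (pathSum-sub x y L))
      (solve 4 (λ a b c d → (a :- b) :+ (c :- d) := (a :+ c) :- (b :+ d)) refl
        (x k l) (y k l) (pathSum x L) (pathSum y L))

  pathSum-χ-avoiding : ∀ {A L} → All (_∉ₛ A) L → pathSum (χ A) L ≡ 0ℚ
  pathSum-χ-avoiding [] = refl
  pathSum-χ-avoiding {A} (p∉A ∷ ps∉A) rewrite χ-∉ {A} p∉A | pathSum-χ-avoiding ps∉A = refl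

  0≤pathSum-χ : ∀ A L → 0ℚ ≤ pathSum (χ A) L
  0≤pathSum-χ A [] = ℚ.≤-refl
  0≤pathSum-χ A ((k , l) ∷ L) = ℚ.+-mono-≤ (0≤χ A k l) (0≤pathSum-χ A L)

  pathSum-χ-meeting : ∀ {A L} → Any (_∈ₛ A) L → 1ℚ ≤ pathSum (χ A) L
  pathSum-χ-meeting {A} {(k , l) ∷ L} (here p∈A) rewrite χ-∈ {A} p∈A =
    p≤p+q (0≤pathSum-χ A L)
  pathSum-χ-meeting {A} {(k , l) ∷ L} (there meets) =
    ℚ.≤-trans (pathSum-χ-meeting meets) (p≤q+p (0≤χ A k l))

  pathSum-scaledχ-avoiding : ∀ {a A L} → All (_∉ₛ A) L → pathSum (scaledχ a A) L ≡ 0ℚ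
  pathSum-scaledχ-avoiding {a} {A} {L} avoids = begin
    pathSum (scaledχ a A) L    ≡⟨ pathSum-scale (toℚ a) (χ A) L ⟩
    toℚ a * pathSum (χ A) L    ≡⟨ cong (toℚ a *_) (pathSum-χ-avoiding avoids) ⟩
    toℚ a * 0ℚ                 ≡⟨ ℚ.*-zeroʳ (toℚ a) ⟩
    0ℚ                         ∎
    where open ≡-Reasoning

  pathSum-scaledχ-meeting : ∀ {a A L} → Any (_∈ₛ A) L → toℚ a ≤ pathSum (scaledχ a A) L
  pathSum-scaledχ-meeting {a} {A} {L} meets = begin
    toℚ a                      ≡⟨ sym (ℚ.*-identityʳ (toℚ a)) ⟩
    toℚ a * 1ℚ                 ≤⟨ ℚ.*-monoˡ-≤-nonNeg (toℚ a) {{nonNegative (0≤toℚ a)}}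
                                    (pathSum-χ-meeting meets) ⟩
    toℚ a * pathSum (χ A) L    ≡⟨ sym (pathSum-scale (toℚ a) (χ A) L) ⟩
    pathSum (scaledχ a A) L    ∎
    where open ℚ.≤-Reasoning

  pathSum-χ-chain : ∀ {A p ps} → Antichain A → Chain p ps → pathSum (χ A) (p ∷ ps) ≤ 1ℚ
  pathSum-χ-chain {A} {k , l} {ps} anti ch with (k , l) ∈ₛ? A
  ... | yes p∈A rewrite χ-∈ {A} p∈A | pathSum-χ-avoiding (Chain-leaves-antichain anti ch p∈A) =
    ℚ.≤-reflexive (ℚ.+-identityʳ 1ℚ)
  ... | no p∉A rewrite χ-∉ {A} p∉A = subst (_≤ 1ℚ) (sym (ℚ.+-identityˡ _)) (rest ps ch)
    where
    rest : ∀ qs → Chain (k , l) qs → pathSum (χ A) qs ≤ 1ℚ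
    rest [] _ = ℚ.<⇒≤ 0<1
    rest (_ ∷ _) (_ , ch′) = pathSum-χ-chain anti ch′

  M≡a : ∀ {i a p ps} → proj₁ p ℕ.≤ i → i ℕ.≤ proj₁ (lastOf p ps) → M i a p ps ≡ toℚ a
  M≡a p≤i i≤last
    rewrite Equivalence.to T-≡ (ℕ.≤⇒≤ᵇ p≤i) | Equivalence.to T-≡ (ℕ.≤⇒≤ᵇ i≤last) = refl

  M-cases : ∀ i a p ps → M i a p ps ≡ 0ℚ ⊎ (proj₁ p ℕ.≤ i × i ℕ.≤ proj₁ (lastOf p ps))
  M-cases i a p ps with (proj₁ p ℕ.≤ᵇ i) ∧ (i ℕ.≤ᵇ proj₁ (lastOf p ps)) in both
  ... | false = inj₁ refl
  ... | true =
    let (p≤i , i≤last) = Equivalence.to T-∧ (Equivalence.from T-≡ both)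
    in inj₂ (ℕ.≤ᵇ⇒≤ _ _ p≤i , ℕ.≤ᵇ⇒≤ _ _ i≤last)

  0≤M : ∀ i a p ps → 0ℚ ≤ M i a p ps
  0≤M i a p ps with M-cases i a p ps
  ... | inj₁ M≡0 = ℚ.≤-reflexive (sym M≡0)
  ... | inj₂ (p≤i , i≤last) = subst (0ℚ ≤_) (sym (M≡a {a = a} {ps = ps} p≤i i≤last)) (0≤toℚ a)

  data DyckPrefix (n k₀ : ℕ) : ℕ × ℕ → Set where
    diagonal : Valid n (k₀ , suc k₀) → DyckPrefix n k₀ (k₀ , suc k₀)
    snoc : ∀ {p q} → DyckPrefix n k₀ p → Step p q → Valid n q → DyckPrefix n k₀ q

  module _ {n k₀ : ℕ} where

    following : ∀ {q} → DyckPrefix n k₀ q → List (ℕ × ℕ) → List (ℕ × ℕ)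
    following (diagonal _) ps = ps
    following (snoc {q = q} π _ _) ps = following π (q ∷ ps)

    weight : ∀ {q} → Point → DyckPrefix n k₀ q → ℚ
    weight x (diagonal _) = x k₀ (suc k₀)
    weight x (snoc {q = k , l} π _ _) = weight x π + x k l

    origin≤ : ∀ {q} → DyckPrefix n k₀ q → k₀ ℕ.≤ proj₁ q
    origin≤ (diagonal _) = ℕ.≤-refl
    origin≤ (snoc π s _) = ℕ.≤-trans (origin≤ π) (proj₁ (proj₁ (Step⇒≺ s)))

    lastOf-following : ∀ {q} (π : DyckPrefix n k₀ q) ps → lastOf (k₀ , suc k₀) (following π ps) ≡ lastOf q ps
    lastOf-following (diagonal _) ps = refl
    lastOf-following (snoc {q = q} π _ _) ps = lastOf-following π (q ∷ ps)

    pathSum-following : ∀ {q} x (π : DyckPrefix n k₀ q) ps →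
      pathSum x ((k₀ , suc k₀) ∷ following π ps) ≡ weight x π + pathSum x ps
    pathSum-following x (diagonal _) ps = refl
    pathSum-following x (snoc {q = k , l} π _ _) ps =
      trans (pathSum-following x π ((k , l) ∷ ps)) (sym (ℚ.+-assoc (weight x π) (x k l) (pathSum x ps)))

    following-chain : ∀ {q ps} (π : DyckPrefix n k₀ q) → Chain q ps → Chain (k₀ , suc k₀) (following π ps)
    following-chain (diagonal _) ch = ch
    following-chain (snoc π s _) ch = following-chain π (s , ch)

    following-valid : ∀ {q ps} (π : DyckPrefix n k₀ q) → All (Valid n) ps →
      All (Valid n) ((k₀ , suc k₀) ∷ following π ps)
    following-valid (diagonal v) vs = v ∷ vs
    following-valid (snoc π _ v) vs = following-valid π (v ∷ vs)

    following-isDyck : ∀ {q ps} (π : DyckPrefix n k₀ q) → Chain q ps → All (Valid n) ps →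
      Diag (lastOf q ps) → IsDyck n (k₀ , suc k₀) (following π ps)
    following-isDyck {ps = ps} π ch vs last-diag =
      following-valid π vs , following-chain π ch , refl , subst Diag (sym (lastOf-following π ps)) last-diag

    weight-nonneg : ∀ {x q} → Nonneg n x → (π : DyckPrefix n k₀ q) → 0ℚ ≤ weight x π
    weight-nonneg x≥0 (diagonal v) = x≥0 _ _ v
    weight-nonneg x≥0 (snoc {q = k , l} π _ v) = ℚ.+-mono-≤ (weight-nonneg x≥0 π) (x≥0 k l v)

    endpoint≤weight : ∀ {x k l} → Nonneg n x → (π : DyckPrefix n k₀ (k , l)) → x k l ≤ weight x π
    endpoint≤weight x≥0 (diagonal _) = ℚ.≤-refl
    endpoint≤weight x≥0 (snoc π _ _) = p≤q+p (weight-nonneg x≥0 π)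

  row : ∀ {n k l} → 1 ℕ.≤ k → k ℕ.< l → l ℕ.≤ n → DyckPrefix n k (k , l)
  row {k = k} {suc l} 1≤k k<1+l 1+l≤n with k ℕ.<? l
  ... | yes k<l = snoc (row 1≤k k<l (ℕ.<⇒≤ 1+l≤n)) (inj₂ (refl , refl)) (1≤k , k<1+l , 1+l≤n)
  ... | no k≮l with ℕ.≤-antisym (ℕ.≮⇒≥ k≮l) (ℕ.≤-pred k<1+l)
  ...   | refl = diagonal (1≤k , k<1+l , 1+l≤n)

  column : ℕ → ℕ → ℕ → List (ℕ × ℕ)
  column k zero l = []
  column k (suc m) l = (suc k , l) ∷ column (suc k) m l

  column-chain : ∀ k m l → Chain (k , l) (column k m l)
  column-chain k zero l = _
  column-chain k (suc m) l = inj₁ (refl , refl) , column-chain (suc k) m l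

  column-last : ∀ k m l → lastOf (k , l) (column k m l) ≡ (m ℕ.+ k , l)
  column-last k zero l = refl
  column-last k (suc m) l = trans (column-last (suc k) m l) (cong (_, l) (ℕ.+-suc m k))

  column-valid : ∀ {n} k m {l} → m ℕ.+ k ℕ.< l → l ℕ.≤ n → All (Valid n) (column k m l)
  column-valid k zero _ _ = []
  column-valid k (suc m) {l} m+k<l l≤n =
    (s≤s z≤n , ℕ.≤-<-trans (s≤s (ℕ.m≤n+m k m)) m+k<l , l≤n) ∷
    column-valid (suc k) m (subst (ℕ._< l) (sym (ℕ.+-suc m k)) m+k<l) l≤n

  -- heaviest x k l is the largest weight of a Dyck prefix ending at (k , l), and 0 off the valid range.
  heaviest : Point → ℕ → ℕ → ℚ
  heaviest x zero l = 0ℚ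
  heaviest x (suc k) zero = 0ℚ
  heaviest x (suc k) (suc l) =
    if does (k ℕ.<? l) then x (suc k) (suc l) + (heaviest x k (suc l) ⊔ heaviest x (suc k) l) else 0ℚ

  module _ (x : Point) where

    heaviest-unfold : ∀ {k l} → k ℕ.< l →
      heaviest x (suc k) (suc l) ≡ x (suc k) (suc l) + (heaviest x k (suc l) ⊔ heaviest x (suc k) l)
    heaviest-unfold {k = k} {l} k<l rewrite dec-true (k ℕ.<? l) k<l = refl

    heaviest-off : ∀ {k l} → ¬ k ℕ.< l → heaviest x k l ≡ 0ℚ
    heaviest-off {k = zero} _ = refl
    heaviest-off {k = suc k} {zero} _ = refl
    heaviest-off {k = suc k} {suc l} k≮l rewrite dec-false (k ℕ.<? l) (k≮l ∘ s≤s) = refl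

    heaviest-up : ∀ {k l} → k ℕ.< l → x (suc k) (suc l) + heaviest x k (suc l) ≤ heaviest x (suc k) (suc l)
    heaviest-up {k} {l} k<l = subst (x (suc k) (suc l) + heaviest x k (suc l) ≤_) (sym (heaviest-unfold k<l))
      (ℚ.+-monoʳ-≤ (x (suc k) (suc l)) (ℚ.p≤p⊔q (heaviest x k (suc l)) (heaviest x (suc k) l)))

    heaviest-left : ∀ {k l} → k ℕ.< l → x (suc k) (suc l) + heaviest x (suc k) l ≤ heaviest x (suc k) (suc l)
    heaviest-left {k} {l} k<l = subst (x (suc k) (suc l) + heaviest x (suc k) l ≤_) (sym (heaviest-unfold k<l))
      (ℚ.+-monoʳ-≤ (x (suc k) (suc l)) (ℚ.p≤q⊔p (heaviest x k (suc l)) (heaviest x (suc k) l)))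

  module _ {n : ℕ} {x : Point} (x≥0 : Nonneg n x) where

    heaviest-nonneg : ∀ k {l} → l ℕ.≤ n → 0ℚ ≤ heaviest x k l
    heaviest-nonneg zero _ = ℚ.≤-refl
    heaviest-nonneg (suc k) {zero} _ = ℚ.≤-refl
    heaviest-nonneg (suc k) {suc l} 1+l≤n with k ℕ.<? l
    ... | yes k<l = ℚ.≤-trans (heaviest-nonneg k 1+l≤n)
      (ℚ.≤-trans (p≤q+p (x≥0 (suc k) (suc l) (s≤s z≤n , s≤s k<l , 1+l≤n))) (heaviest-up x k<l))
    ... | no k≮l = ℚ.≤-reflexive (sym (heaviest-off x (k≮l ∘ ℕ.≤-pred)))

    x≤heaviest : ∀ {k l} → Valid n (k , l) → x k l ≤ heaviest x k l
    x≤heaviest {zero} (() , _)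
    x≤heaviest {suc k} {zero} (_ , () , _)
    x≤heaviest {suc k} {suc l} (_ , s≤s k<l , 1+l≤n) =
      ℚ.≤-trans (p≤p+q (heaviest-nonneg k 1+l≤n)) (heaviest-up x k<l)

    heaviest-mono : ∀ {k l K L} → Valid n (k , l) → Valid n (K , L) → (k , l) ⪯ (K , L) →
      heaviest x k l ≤ heaviest x K L
    heaviest-strict : ∀ {k l K L} → Valid n (k , l) → Valid n (K , L) → (k , l) ⪯ (K , L) →
      (k , l) ≢ (K , L) → x K L + heaviest x k l ≤ heaviest x K L

    heaviest-mono {k} {l} {K} {L} v w p⪯q with ≡-dec ℕ._≟_ ℕ._≟_ (k , l) (K , L)
    ... | yes refl = ℚ.≤-refl
    ... | no p≢q = ℚ.≤-trans (p≤q+p (x≥0 K L w)) (heaviest-strict v w p⪯q p≢q)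

    heaviest-strict {K = zero} _ (() , _) _ _
    heaviest-strict {K = suc K} {zero} _ (_ , () , _) _ _
    heaviest-strict {k} {l} {suc K} {suc L} v@(1≤k , k<l , _) (_ , s≤s K<L , 1+L≤n) (k≤1+K , l≤1+L) p≢q
      with k ℕ.≤? K | l ℕ.≤? L
    ... | yes k≤K | _ = ℚ.≤-trans (ℚ.+-monoʳ-≤ (x (suc K) (suc L)) below-up) (heaviest-up x K<L)
      where
      below-up =
        heaviest-mono {K = K} {suc L} v (ℕ.≤-trans 1≤k k≤K , ℕ.m<n⇒m<1+n K<L , 1+L≤n) (k≤K , l≤1+L)
    ... | no k≰K | yes l≤L = ℚ.≤-trans (ℚ.+-monoʳ-≤ (x (suc K) (suc L)) below-left) (heaviest-left x K<L)
      where
      1+K<L = ℕ.<-≤-trans (ℕ.≤-<-trans (ℕ.≰⇒> k≰K) k<l) l≤L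
      below-left = heaviest-mono {K = suc K} {L} v (s≤s z≤n , 1+K<L , ℕ.<⇒≤ 1+L≤n) (k≤1+K , l≤L)
    ... | no k≰K | no l≰L =
      contradiction (cong₂ _,_ (ℕ.≤-antisym k≤1+K (ℕ.≰⇒> k≰K)) (ℕ.≤-antisym l≤1+L (ℕ.≰⇒> l≰L)))
        p≢q

    Realising : ℕ × ℕ → Set
    Realising (k , l) = Σ[ k₀ ∈ ℕ ] Σ[ π ∈ DyckPrefix n k₀ (k , l) ] heaviest x k l ≤ weight x π

    realising-snoc : ∀ {p k l} → Realising p → Step p (suc k , suc l) → Valid n (suc k , suc l) →
      heaviest x k (suc l) ⊔ heaviest x (suc k) l ≤ heaviest x (proj₁ p) (proj₂ p) →
      Realising (suc k , suc l)
    realising-snoc {k = k} {l} (k₀ , π , heaviest≤π) s v@(_ , s≤s k<l , _) max≤ =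
      k₀ , snoc π s v , (begin
        heaviest x (suc k) (suc l)
          ≡⟨ heaviest-unfold x k<l ⟩
        x (suc k) (suc l) + (heaviest x k (suc l) ⊔ heaviest x (suc k) l)
          ≤⟨ ℚ.+-monoʳ-≤ (x (suc k) (suc l)) (ℚ.≤-trans max≤ heaviest≤π) ⟩
        x (suc k) (suc l) + weight x π
          ≡⟨ ℚ.+-comm _ (weight x π) ⟩
        weight x π + x (suc k) (suc l)
          ∎)
      where open ℚ.≤-Reasoning

    realising-from-predecessors : ∀ {k l} → Valid n (suc (suc k) , suc l) → Realising (suc k , suc l) →
      (suc (suc k) ℕ.< l → Realising (suc (suc k) , l)) → Realising (suc (suc k) , suc l)
    realising-from-predecessors {k} {l} v@(_ , _ , 1+l≤n) up left with suc (suc k) ℕ.<? l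
    ... | no left-invalid = realising-snoc up (inj₁ (refl , refl)) v
      (ℚ.⊔-lub ℚ.≤-refl (subst (_≤ heaviest x (suc k) (suc l)) (sym (heaviest-off x left-invalid))
                               (heaviest-nonneg (suc k) 1+l≤n)))
    ... | yes left-valid with heaviest x (suc k) (suc l) ℚ.≤? heaviest x (suc (suc k)) l
    ...   | yes up≤left =
      realising-snoc (left left-valid) (inj₂ (refl , refl)) v (ℚ.⊔-lub up≤left ℚ.≤-refl)
    ...   | no up≰left =
      realising-snoc up (inj₁ (refl , refl)) v (ℚ.⊔-lub ℚ.≤-refl (ℚ.<⇒≤ (ℚ.≰⇒> up≰left)))

    heaviest-realised : ∀ {k l} → Valid n (k , l) → Realising (k , l)
    heaviest-realised {zero} (() , _)
    heaviest-realised {suc k} {zero} (_ , () , _)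
    heaviest-realised {1} {1} (_ , s≤s () , _)
    heaviest-realised {1} {2} v = 1 , diagonal v , ℚ.≤-reflexive (ℚ.+-identityʳ (x 1 2))
    heaviest-realised {1} {suc (suc (suc l))} v@(_ , _ , 3+l≤n) =
      realising-snoc (heaviest-realised (s≤s z≤n , s≤s (s≤s z≤n) , ℕ.<⇒≤ 3+l≤n)) (inj₂ (refl , refl)) v
        (ℚ.⊔-lub (heaviest-nonneg 1 (ℕ.<⇒≤ 3+l≤n)) ℚ.≤-refl)
    heaviest-realised {suc (suc k)} {suc l} v@(_ , 2+k<1+l , 1+l≤n) =
      realising-from-predecessors v
        (heaviest-realised (s≤s z≤n , ℕ.<-trans (ℕ.n<1+n (suc k)) 2+k<1+l , 1+l≤n))
        (λ left-valid → heaviest-realised (s≤s z≤n , left-valid , ℕ.<⇒≤ 1+l≤n))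

  positive-lower-bound : ∀ (f : ℕ → ℚ) m →
    ∃[ τ ] 0ℚ < τ × (∀ {j} → j ℕ.< m → 0ℚ < f j → τ ≤ f j)
  positive-lower-bound f zero = 1ℚ , 0<1 , λ ()
  positive-lower-bound f (suc m) with positive-lower-bound f m | 0ℚ ℚ.<? f m
  ... | τ , 0<τ , below | yes 0<fm = τ ⊓ f m , pos⊓pos 0<τ 0<fm , below′
    where
    below′ : ∀ {j} → j ℕ.< suc m → 0ℚ < f j → τ ⊓ f m ≤ f j
    below′ j<1+m 0<fj with ℕ.m<1+n⇒m<n∨m≡n j<1+m
    ... | inj₁ j<m = ℚ.≤-trans (ℚ.p⊓q≤p τ (f m)) (below j<m 0<fj)
    ... | inj₂ refl = ℚ.p⊓q≤q τ (f m)
  ... | τ , 0<τ , below | no 0≮fm = τ , 0<τ , below′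
    where
    below′ : ∀ {j} → j ℕ.< suc m → 0ℚ < f j → τ ≤ f j
    below′ j<1+m 0<fj with ℕ.m<1+n⇒m<n∨m≡n j<1+m
    ... | inj₁ j<m = below j<m 0<fj
    ... | inj₂ refl = contradiction 0<fj 0≮fm

  positive-lower-bound₂ : ∀ (f : ℕ → ℕ → ℚ) m →
    ∃[ τ ] 0ℚ < τ × (∀ {k l} → k ℕ.< m → l ℕ.< m → 0ℚ < f k l → τ ≤ f k l)
  positive-lower-bound₂ f m with positive-lower-bound (λ k → proj₁ (positive-lower-bound (f k) m)) m
  ... | τ , 0<τ , below = τ , 0<τ , λ {k} k<m l<m 0<fkl →
    let (_ , 0<τₖ , belowₖ) = positive-lower-bound (f k) m in ℚ.≤-trans (below k<m 0<τₖ) (belowₖ l<m 0<fkl)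

  small-multiple : ∀ {α τ} → 0ℚ < α → 0ℚ < τ → ∃[ t ] 0ℚ < t × t < 1ℚ × t * α ≤ τ
  small-multiple {α} {τ} 0<α 0<τ =
    (τ * 1/α) ⊓ ½ , pos⊓pos 0<τ/α 0<½ , ℚ.≤-<-trans (ℚ.p⊓q≤q (τ * 1/α) ½) ½<1 , (begin
    ((τ * 1/α) ⊓ ½) * α  ≤⟨ ℚ.*-monoʳ-≤-nonNeg α {{nonNegative (ℚ.<⇒≤ 0<α)}} (ℚ.p⊓q≤p (τ * 1/α) ½) ⟩
    (τ * 1/α) * α        ≡⟨ ℚ.*-assoc τ 1/α α ⟩
    τ * (1/α * α)        ≡⟨ cong (τ *_) (ℚ.*-inverseˡ α {{>-nonZero 0<α}}) ⟩
    τ * 1ℚ               ≡⟨ ℚ.*-identityʳ τ ⟩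
    τ                    ∎)
    where
    open ℚ.≤-Reasoning
    1/α = (1/ α) {{>-nonZero 0<α}}
    0<τ/α : 0ℚ < τ * 1/α
    0<τ/α = ℚ.positive⁻¹ _ {{ℚ.pos*pos⇒pos τ {{positive 0<τ}} 1/α {{ℚ.1/pos⇒pos α {{positive 0<α}}}}}}
    0<½ : 0ℚ < ½
    0<½ = ℚ.positive⁻¹ ½
    ½<1 : ½ < 1ℚ
    ½<1 = toWitness {a? = ½ ℚ.<? 1ℚ} _

  module _ {n i a : ℕ} where

    InP-cong : ∀ {x y} → x ≈[ n ] y → InP n i a y → InP n i a x
    InP-cong x≈y (y≥0 , y-paths) =
      (λ k l v → subst (0ℚ ≤_) (sym (x≈y k l v)) (y≥0 k l v)) ,
      (λ p ps d → subst (_≤ M i a p ps) (sym (pathSum-cong (proj₁ d) x≈y)) (y-paths p ps d))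

    -- A Dyck path meets the antichain A at most once, and if it meets A ⊆ Q at c then
    -- i₁ ≤ c₁ ≤ i < c₂ ≤ i_N + 1, so M(d) = a.
    indicator∈P : ∀ {A} → SubsetOfQ n i A → Antichain A → InP n i a (scaledχ a A)
    indicator∈P {A} A⊆Q anti = (λ k l _ → nonneg*nonneg (0≤toℚ a) (0≤χ A k l)) , bounded
      where
      bounded : ∀ p ps → IsDyck n p ps → pathSum (scaledχ a A) (p ∷ ps) ≤ M i a p ps
      bounded p ps (_ , ch , _ , last-diag) rewrite pathSum-scale (toℚ a) (χ A) (p ∷ ps)
        with All.search (_∈ₛ? A) (p ∷ ps)
      ... | inj₁ avoids rewrite pathSum-χ-avoiding avoids | ℚ.*-zeroʳ (toℚ a) = 0≤M i a p ps
      ... | inj₂ meets =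
        subst (toℚ a * pathSum (χ A) (p ∷ ps) ≤_) (sym (M≡a {a = a} {ps = ps} (proj₁ bounds) (proj₂ bounds)))
          at-most-a
        where
        at-most-a : toℚ a * pathSum (χ A) (p ∷ ps) ≤ toℚ a
        at-most-a = subst (toℚ a * pathSum (χ A) (p ∷ ps) ≤_) (ℚ.*-identityʳ (toℚ a))
          (ℚ.*-monoˡ-≤-nonNeg (toℚ a) {{nonNegative (0≤toℚ a)}} (pathSum-χ-chain anti ch))
        conditions : ∀ {c} → p ⪯ c × c ⪯ lastOf p ps → c ∈ₛ A →
          proj₁ p ℕ.≤ i × i ℕ.≤ proj₁ (lastOf p ps)
        conditions {c} ((p≤c , _) , c⪯last) c∈A =
          let (_ , c≤i , i<c , _) = A⊆Q c c∈A
          in ℕ.≤-trans p≤c c≤i , ℕ.≤-pred (ℕ.≤-trans i<c (⪯-Diag c⪯last last-diag))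
        bounds = All.lookupWith conditions (All.zip (Chain⇒first⪯ ch , Chain⇒⪯last ch)) meets

    -- The hook (k , k+1) → (k , l) → (l-1 , l) is a Dyck path through (k , l) with M = a exactly on Q.
    coordinate-bound : ∀ {y k l} → InP n i a y → Valid n (k , l) →
      y k l ≤ 0ℚ ⊎ (InQ n i (k , l) × y k l ≤ toℚ a)
    coordinate-bound {y} {k} (y≥0 , y-paths) (1≤k , k<l , l≤n) with ℕ.m≤n⇒∃[o]m+o≡n k<l
    ... | m , refl = by-cases (M-cases i a (k , suc k) hook)
      where
      l = suc (k ℕ.+ m)
      π = row 1≤k k<l l≤n
      hook = following π (column k m l)
      last≡ : lastOf (k , suc k) hook ≡ (m ℕ.+ k , l)
      last≡ = trans (lastOf-following π _) (column-last k m l)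
      column-ok : All (Valid n) (column k m l)
      column-ok = column-valid k m (s≤s (ℕ.≤-reflexive (ℕ.+-comm m k))) l≤n
      hook-isDyck : IsDyck n (k , suc k) hook
      hook-isDyck = following-isDyck π (column-chain k m l) column-ok
        (subst Diag (sym (column-last k m l)) (cong suc (ℕ.+-comm k m)))
      y≤M : y k l ≤ M i a (k , suc k) hook
      y≤M = begin
        y k l                                  ≤⟨ endpoint≤weight y≥0 π ⟩
        weight y π                             ≤⟨ p≤p+q (pathSum-nonneg y≥0 column-ok) ⟩
        weight y π + pathSum y (column k m l)  ≡⟨ sym (pathSum-following y π (column k m l)) ⟩
        pathSum y ((k , suc k) ∷ hook)         ≤⟨ y-paths (k , suc k) hook hook-isDyck ⟩
        M i a (k , suc k) hook                 ∎
        where open ℚ.≤-Reasoning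
      by-cases : M i a (k , suc k) hook ≡ 0ℚ ⊎ (k ℕ.≤ i × i ℕ.≤ proj₁ (lastOf (k , suc k) hook)) →
        y k l ≤ 0ℚ ⊎ (InQ n i (k , l) × y k l ≤ toℚ a)
      by-cases (inj₁ M≡0) = inj₁ (subst (y k l ≤_) M≡0 y≤M)
      by-cases (inj₂ (k≤i , i≤last)) =
        inj₂ ((1≤k , k≤i , s≤s i≤k+m , l≤n) , subst (y k l ≤_) (M≡a {a = a} {ps = hook} k≤i i≤last) y≤M)
        where
        i≤k+m = subst (i ℕ.≤_) (ℕ.+-comm m k) (subst (λ e → i ℕ.≤ proj₁ e) last≡ i≤last)

    InP⇒≤a : ∀ {y k l} → InP n i a y → Valid n (k , l) → y k l ≤ toℚ a
    InP⇒≤a yP v with coordinate-bound yP v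
    ... | inj₁ y≤0 = ℚ.≤-trans y≤0 (0≤toℚ a)
    ... | inj₂ (_ , y≤a) = y≤a

    InP⇒support⊆Q : ∀ {y k l} → InP n i a y → Valid n (k , l) → 0ℚ < y k l → InQ n i (k , l)
    InP⇒support⊆Q yP v 0<y with coordinate-bound yP v
    ... | inj₁ y≤0 = contradiction (ℚ.<-≤-trans 0<y y≤0) (ℚ.<-irrefl refl)
    ... | inj₂ (k,l∈Q , _) = k,l∈Q

    indicator-isVertex : ∀ {A} → SubsetOfQ n i A → Antichain A → IsVertex n i a (scaledχ a A)
    indicator-isVertex {A} A⊆Q anti = indicator∈P A⊆Q anti , extreme
      where
      extreme : ∀ y z t → InP n i a y → InP n i a z → 0ℚ < t → t < 1ℚ →
        scaledχ a A ≈[ n ] (λ k l → t * y k l + (1ℚ - t) * z k l) → y ≈[ n ] z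
      extreme y z t yP zP 0<t t<1 split k l v =
        convex-endpoint 0<t t<1 (proj₁ yP k l v) (InP⇒≤a yP v) (proj₁ zP k l v) (InP⇒≤a zP v) endpoint
        where
        endpoint : t * y k l + (1ℚ - t) * z k l ≡ 0ℚ ⊎ t * y k l + (1ℚ - t) * z k l ≡ toℚ a
        endpoint with (k , l) ∈ₛ? A
        ... | yes k,l∈A = inj₂ (trans (sym (split k l v)) (scaledχ-∈ {a} {A} k,l∈A))
        ... | no k,l∉A = inj₁ (trans (sym (split k l v)) (scaledχ-∉ {a} {A} k,l∉A))

    AvoidersHaveSlack : Point → Subset → ℚ → Set
    AvoidersHaveSlack x A τ = ∀ p ps → IsDyck n p ps → i ℕ.≤ proj₁ (lastOf p ps) →
      All (_∉ₛ A) (p ∷ ps) → pathSum x (p ∷ ps) + τ ≤ toℚ a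

    module Residual {x : Point} {A : Subset} {t : ℚ} (A⊆Q : SubsetOfQ n i A) (anti : Antichain A)
      (xP : InP n i a x) (0<t : 0ℚ < t) (t<1 : t < 1ℚ)
      (ta≤x : ∀ {k l} → Valid n (k , l) → (k , l) ∈ₛ A → t * toℚ a ≤ x k l)
      (slack : AvoidersHaveSlack x A (t * toℚ a)) where

      private
        y = scaledχ a A
        0<1-t = p<q⇒0<q-p t<1
        w = (1/ (1ℚ - t)) {{>-nonZero 0<1-t}}

      residual : Point
      residual k l = w * (x k l - t * y k l)

      split : ∀ k l → x k l ≡ t * y k l + (1ℚ - t) * residual k l
      split k l = begin
        x k l
          ≡⟨ solve 2 (λ x ty → x := ty :+ con 1ℚ :* (x :- ty)) refl (x k l) (t * y k l) ⟩
        t * y k l + 1ℚ * (x k l - t * y k l)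
          ≡⟨ cong (λ c → t * y k l + c * (x k l - t * y k l)) (sym [1-t]w≡1) ⟩
        t * y k l + ((1ℚ - t) * w) * (x k l - t * y k l)
          ≡⟨ cong (t * y k l +_) (ℚ.*-assoc (1ℚ - t) w _) ⟩
        t * y k l + (1ℚ - t) * residual k l
          ∎
        where
        open ≡-Reasoning
        [1-t]w≡1 : (1ℚ - t) * w ≡ 1ℚ
        [1-t]w≡1 = ℚ.*-inverseʳ (1ℚ - t) {{>-nonZero 0<1-t}}

      ty≤x : ∀ {k l} → Valid n (k , l) → t * y k l ≤ x k l
      ty≤x {k} {l} v with (k , l) ∈ₛ? A
      ... | yes k,l∈A = subst (λ c → t * c ≤ x k l) (sym (scaledχ-∈ {a} {A} k,l∈A)) (ta≤x v k,l∈A)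
      ... | no k,l∉A = subst (_≤ x k l) (sym (trans (cong (t *_) (scaledχ-∉ {a} {A} k,l∉A)) (ℚ.*-zeroʳ t)))
                         (proj₁ xP k l v)

      pathSum-x-ty≤[1-t]M : ∀ p ps → IsDyck n p ps →
        pathSum x (p ∷ ps) - t * pathSum y (p ∷ ps) ≤ (1ℚ - t) * M i a p ps
      pathSum-x-ty≤[1-t]M p ps d with M-cases i a p ps
      ... | inj₁ M≡0 = begin
        S - t * Y              ≤⟨ p-q≤p (nonneg*nonneg (ℚ.<⇒≤ 0<t) 0≤Y) ⟩
        S                      ≤⟨ proj₂ xP p ps d ⟩
        M i a p ps             ≡⟨ M≡0 ⟩
        0ℚ                     ≡⟨ sym (ℚ.*-zeroʳ (1ℚ - t)) ⟩
        (1ℚ - t) * 0ℚ          ≡⟨ cong ((1ℚ - t) *_) (sym M≡0) ⟩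
        (1ℚ - t) * M i a p ps  ∎
        where
        open ℚ.≤-Reasoning
        S = pathSum x (p ∷ ps)
        Y = pathSum y (p ∷ ps)
        0≤Y = pathSum-nonneg (proj₁ (indicator∈P A⊆Q anti)) (proj₁ d)
      ... | inj₂ (p≤i , i≤last) = begin
        S - t * Y              ≤⟨ by-search (All.search (_∈ₛ? A) (p ∷ ps)) ⟩
        toℚ a - t * toℚ a      ≡⟨ solve 2 (λ a t → a :- t :* a := (con 1ℚ :- t) :* a) refl (toℚ a) t ⟩
        (1ℚ - t) * toℚ a       ≡⟨ cong ((1ℚ - t) *_) (sym M≡a′) ⟩
        (1ℚ - t) * M i a p ps  ∎
        where
        open ℚ.≤-Reasoning
        S = pathSum x (p ∷ ps)
        Y = pathSum y (p ∷ ps)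
        M≡a′ = M≡a {a = a} {ps = ps} p≤i i≤last
        by-search : All (_∉ₛ A) (p ∷ ps) ⊎ Any (_∈ₛ A) (p ∷ ps) → S - t * Y ≤ toℚ a - t * toℚ a
        by-search (inj₁ avoids) =
          subst (_≤ toℚ a - t * toℚ a) (sym S-tY≡S) (p+q≤r⇒p≤r-q (slack p ps d i≤last avoids))
          where
          S-tY≡S : S - t * Y ≡ S
          S-tY≡S = begin-equality
            S - t * Y   ≡⟨ cong (λ c → S - t * c) (pathSum-scaledχ-avoiding {a} avoids) ⟩
            S - t * 0ℚ  ≡⟨ solve 2 (λ S t → S :- t :* con 0ℚ := S) refl S t ⟩
            S           ∎
        by-search (inj₂ meets) =
          ℚ.+-mono-≤ (subst (S ≤_) M≡a′ (proj₂ xP p ps d))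
            (ℚ.neg-antimono-≤ (ℚ.*-monoˡ-≤-nonNeg t {{nonNegative (ℚ.<⇒≤ 0<t)}}
                                 (pathSum-scaledχ-meeting {a} meets)))

      residual∈P : InP n i a residual
      residual∈P = (λ k l v → nonneg*nonneg 0≤w (p≤q⇒0≤q-p (ty≤x v))) , bounded
        where
        0≤w : 0ℚ ≤ w
        0≤w = ℚ.<⇒≤ (ℚ.positive⁻¹ w {{ℚ.1/pos⇒pos (1ℚ - t) {{positive 0<1-t}}}})
        bounded : ∀ p ps → IsDyck n p ps → pathSum residual (p ∷ ps) ≤ M i a p ps
        bounded p ps d = begin
          pathSum residual (p ∷ ps)
            ≡⟨ pathSum-scale w (λ k l → x k l - t * y k l) (p ∷ ps) ⟩
          w * pathSum (λ k l → x k l - t * y k l) (p ∷ ps)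
            ≡⟨ cong (w *_) (pathSum-sub x (λ k l → t * y k l) (p ∷ ps)) ⟩
          w * (S - pathSum (λ k l → t * y k l) (p ∷ ps))
            ≡⟨ cong (λ c → w * (S - c)) (pathSum-scale t y (p ∷ ps)) ⟩
          w * (S - t * pathSum y (p ∷ ps))
            ≤⟨ ℚ.*-monoˡ-≤-nonNeg w {{nonNegative 0≤w}} (pathSum-x-ty≤[1-t]M p ps d) ⟩
          w * ((1ℚ - t) * M i a p ps)
            ≡⟨ sym (ℚ.*-assoc w (1ℚ - t) _) ⟩
          (w * (1ℚ - t)) * M i a p ps
            ≡⟨ cong (_* M i a p ps) (ℚ.*-inverseˡ (1ℚ - t) {{>-nonZero 0<1-t}}) ⟩
          1ℚ * M i a p ps
            ≡⟨ ℚ.*-identityˡ _ ⟩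
          M i a p ps
            ∎
          where
          open ℚ.≤-Reasoning
          S = pathSum x (p ∷ ps)

    vertex≈indicator : ∀ {x A t} → IsVertex n i a x → SubsetOfQ n i A → Antichain A → 0ℚ < t → t < 1ℚ →
      (∀ {k l} → Valid n (k , l) → (k , l) ∈ₛ A → t * toℚ a ≤ x k l) →
      AvoidersHaveSlack x A (t * toℚ a) → x ≈[ n ] scaledχ a A
    vertex≈indicator {x} {A} {t} (xP , extreme) A⊆Q anti 0<t t<1 ta≤x slack k l v = begin
      x k l                                ≡⟨ split k l ⟩
      t * y k l + (1ℚ - t) * residual k l  ≡⟨ cong (λ c → t * y k l + (1ℚ - t) * c) (sym (y≈residual k l v)) ⟩
      t * y k l + (1ℚ - t) * y k l         ≡⟨ solve 2 (λ t y → t :* y :+ (con 1ℚ :- t) :* y := y)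
                                                refl t (y k l) ⟩
      y k l                                ∎
      where
      open Residual A⊆Q anti xP 0<t t<1 ta≤x slack
      open ≡-Reasoning
      y = scaledχ a A
      y≈residual : y ≈[ n ] residual
      y≈residual = extreme y residual t (indicator∈P A⊆Q anti) residual∈P 0<t t<1 (λ k l _ → split k l)

    -- Up to its first positive entry (k , l) a path contributes nothing; replacing that initial
    -- segment by a heaviest prefix to (k , l) gains at least τ and still yields a Dyck path with M = a.
    module _ {x : Point} {A : Subset} {τ : ℚ} (xP : InP n i a x) (τ≤a : τ ≤ toℚ a)
      (gap : ∀ {k l} → Valid n (k , l) → 0ℚ < x k l → (k , l) ∉ₛ A → x k l + τ ≤ heaviest x k l) where

      private
        AvoidingTailBound : ℕ × ℕ → List (ℕ × ℕ) → Set
        AvoidingTailBound p ps = Chain p ps → All (Valid n) (p ∷ ps) → Diag (lastOf p ps) →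
          i ℕ.≤ proj₁ (lastOf p ps) → All (_∉ₛ A) (p ∷ ps) → pathSum x (p ∷ ps) + τ ≤ toℚ a

      reroute : ∀ {k l} ps → 0ℚ < x k l → AvoidingTailBound (k , l) ps
      reroute {k} {l} ps 0<x ch (v ∷ vs) last-diag i≤last (k,l∉A ∷ _) with heaviest-realised (proj₁ xP) v
      ... | k₀ , π , heaviest≤π = begin
        (x k l + P) + τ
          ≡⟨ solve 3 (λ X P τ → (X :+ P) :+ τ := (X :+ τ) :+ P) refl (x k l) P τ ⟩
        (x k l + τ) + P
          ≤⟨ ℚ.+-monoˡ-≤ P (ℚ.≤-trans (gap v 0<x k,l∉A) heaviest≤π) ⟩
        weight x π + P
          ≡⟨ sym (pathSum-following x π ps) ⟩
        pathSum x ((k₀ , suc k₀) ∷ following π ps)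
          ≤⟨ proj₂ xP _ _ (following-isDyck π ch vs last-diag) ⟩
        M i a (k₀ , suc k₀) (following π ps)
          ≡⟨ M≡a {a = a} {ps = following π ps} k₀≤i i≤last′ ⟩
        toℚ a
          ∎
        where
        open ℚ.≤-Reasoning
        P = pathSum x ps
        k₀≤i = ℕ.≤-trans (origin≤ π) (proj₁ (proj₂ (InP⇒support⊆Q xP v 0<x)))
        i≤last′ = subst (λ q → i ℕ.≤ proj₁ q) (sym (lastOf-following π ps)) i≤last

      avoiding-bound : ∀ p ps → AvoidingTailBound p ps
      avoiding-bound (k , l) ps ch vs last-diag i≤last avoids with 0ℚ ℚ.<? x k l
      ... | yes 0<x = reroute ps 0<x ch vs last-diag i≤last avoids
      avoiding-bound (k , l) [] _ _ _ _ _ | no x≯0 = begin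
        (x k l + 0ℚ) + τ  ≤⟨ ℚ.+-monoˡ-≤ τ (ℚ.+-monoˡ-≤ 0ℚ (ℚ.≮⇒≥ x≯0)) ⟩
        (0ℚ + 0ℚ) + τ     ≡⟨ ℚ.+-identityˡ τ ⟩
        τ                 ≤⟨ τ≤a ⟩
        toℚ a             ∎
        where open ℚ.≤-Reasoning
      avoiding-bound (k , l) (q ∷ qs) (_ , ch) (_ ∷ vs) last-diag i≤last (_ ∷ qs-avoid) | no x≯0 = begin
        (x k l + P) + τ   ≡⟨ ℚ.+-assoc (x k l) P τ ⟩
        x k l + (P + τ)   ≤⟨ ℚ.+-monoˡ-≤ (P + τ) (ℚ.≮⇒≥ x≯0) ⟩
        0ℚ + (P + τ)      ≡⟨ ℚ.+-identityˡ (P + τ) ⟩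
        P + τ             ≤⟨ avoiding-bound q qs ch vs last-diag i≤last qs-avoid ⟩
        toℚ a             ∎
        where
        open ℚ.≤-Reasoning
        P = pathSum x (q ∷ qs)

      heaviest-shortcut : AvoidersHaveSlack x A τ
      heaviest-shortcut p ps (vs , ch , _ , last-diag) = avoiding-bound p ps ch vs last-diag

    -- The ⪯-minimal points of the support of x: heaviest x k l ≤ x k l says that x vanishes below (k , l).
    module MinimalSupport {x : Point} (xP : InP n i a x) where

      Minimal : ℕ → ℕ → Set
      Minimal k l = InQ n i (k , l) × 0ℚ < x k l × heaviest x k l ≤ x k l

      minimal? : ∀ k l → Dec (Minimal k l)
      minimal? k l = (1 ℕ.≤? k ×-dec k ℕ.≤? i ×-dec suc i ℕ.≤? l ×-dec l ℕ.≤? n)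
        ×-dec 0ℚ ℚ.<? x k l ×-dec heaviest x k l ℚ.≤? x k l

      minimalSupport : Subset
      minimalSupport k l = does (minimal? k l)

      ∈minimal : ∀ {k l} → (k , l) ∈ₛ minimalSupport → Minimal k l
      ∈minimal {k} {l} k,l∈ = invert (subst (Reflects (Minimal k l)) k,l∈ (proof (minimal? k l)))

      ∉minimal⇒x<heaviest : ∀ {k l} → Valid n (k , l) → 0ℚ < x k l → (k , l) ∉ₛ minimalSupport →
        x k l < heaviest x k l
      ∉minimal⇒x<heaviest {k} {l} v 0<x k,l∉ =
        ℚ.≰⇒> (λ heaviest≤x → k,l∉ (dec-true (minimal? k l) (InP⇒support⊆Q xP v 0<x , 0<x , heaviest≤x)))

      minimalSupport⊆Q : SubsetOfQ n i minimalSupport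
      minimalSupport⊆Q _ p∈ = proj₁ (∈minimal p∈)

      minimalSupport-antichain : Antichain minimalSupport
      minimalSupport-antichain (k , l) (K , L) p∈ q∈ p⪯q with ≡-dec ℕ._≟_ ℕ._≟_ (k , l) (K , L)
      ... | yes p≡q = p≡q
      ... | no p≢q =
        contradiction (ℚ.<-≤-trans 0<x (ℚ.≤-trans (x≤heaviest x≥0 v) heaviest≤0)) (ℚ.<-irrefl refl)
        where
        x≥0 = proj₁ xP
        v = InQ⇒Valid (proj₁ (∈minimal p∈))
        w = InQ⇒Valid (proj₁ (∈minimal q∈))
        0<x = proj₁ (proj₂ (∈minimal p∈))
        heaviest≤0 : heaviest x k l ≤ 0ℚ
        heaviest≤0 =
          p+q≤p⇒q≤0 (ℚ.≤-trans (heaviest-strict x≥0 v w p⪯q p≢q) (proj₂ (proj₂ (∈minimal q∈))))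

    IsVertex-cong : ∀ {x y} → x ≈[ n ] y → IsVertex n i a y → IsVertex n i a x
    IsVertex-cong x≈y (yP , extreme) =
      InP-cong x≈y yP ,
      λ u v t uP vP 0<t t<1 x≈split →
        extreme u v t uP vP 0<t t<1 (λ k l w → trans (sym (x≈y k l w)) (x≈split k l w))

    indicator⇒vertex : ∀ {x} → Σ Subset (λ A → SubsetOfQ n i A × Antichain A × x ≈[ n ] scaledχ a A) →
      IsVertex n i a x
    indicator⇒vertex (A , A⊆Q , anti , x≈aχ) = IsVertex-cong x≈aχ (indicator-isVertex A⊆Q anti)

    vertex⇒indicator : 1 ℕ.≤ a → ∀ {x} → IsVertex n i a x →
      Σ Subset (λ A → SubsetOfQ n i A × Antichain A × x ≈[ n ] scaledχ a A)
    vertex⇒indicator 1≤a {x} xV@(xP , _)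
      with positive-lower-bound₂ x (suc n) | positive-lower-bound₂ (λ k l → heaviest x k l - x k l) (suc n)
    ... | τ₁ , 0<τ₁ , τ₁≤x | τ₂ , 0<τ₂ , τ₂≤gap
      with small-multiple (0<toℚ 1≤a) (pos⊓pos 0<τ₁ 0<τ₂)
    ... | t , 0<t , t<1 , ta≤τ =
      minimalSupport , minimalSupport⊆Q , minimalSupport-antichain ,
      vertex≈indicator xV minimalSupport⊆Q minimalSupport-antichain 0<t t<1 ta≤x
        (heaviest-shortcut xP ta≤a ta≤gap)
      where
      open MinimalSupport xP
      in-range : ∀ {k l} → Valid n (k , l) → k ℕ.< suc n × l ℕ.< suc n
      in-range (_ , k<l , l≤n) = s≤s (ℕ.≤-trans (ℕ.<⇒≤ k<l) l≤n) , s≤s l≤n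
      ta≤x : ∀ {k l} → Valid n (k , l) → (k , l) ∈ₛ minimalSupport → t * toℚ a ≤ x k l
      ta≤x v k,l∈ = let (k<1+n , l<1+n) = in-range v in
        ℚ.≤-trans ta≤τ (ℚ.≤-trans (ℚ.p⊓q≤p τ₁ τ₂) (τ₁≤x k<1+n l<1+n (proj₁ (proj₂ (∈minimal k,l∈)))))
      ta≤gap : ∀ {k l} → Valid n (k , l) → 0ℚ < x k l → (k , l) ∉ₛ minimalSupport →
        x k l + t * toℚ a ≤ heaviest x k l
      ta≤gap {k} {l} v 0<x k,l∉ = let (k<1+n , l<1+n) = in-range v in begin
        x k l + t * toℚ a
          ≤⟨ ℚ.+-monoʳ-≤ (x k l) (ℚ.≤-trans ta≤τ (ℚ.p⊓q≤q τ₁ τ₂)) ⟩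
        x k l + τ₂
          ≤⟨ ℚ.+-monoʳ-≤ (x k l) (τ₂≤gap k<1+n l<1+n (p<q⇒0<q-p (∉minimal⇒x<heaviest v 0<x k,l∉))) ⟩
        x k l + (heaviest x k l - x k l)
          ≡⟨ solve 2 (λ x h → x :+ (h :- x) := h) refl (x k l) (heaviest x k l) ⟩
        heaviest x k l
          ∎
        where open ℚ.≤-Reasoning
      ta≤a : t * toℚ a ≤ toℚ a
      ta≤a = subst (t * toℚ a ≤_) (ℚ.*-identityˡ (toℚ a))
        (ℚ.*-monoʳ-≤-nonNeg (toℚ a) {{nonNegative (0≤toℚ a)}} (ℚ.<⇒≤ t<1))

open import Data.Nat using (ℕ; _≤_; _∸_)
open import Data.Rational using (_*_)
open import Data.Product using (Σ; _×_)
open import Function.Bundles using (_⇔_; mk⇔)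

proposition2p1 :
    (n i a : ℕ) → 2 ≤ n → 1 ≤ i → i ≤ n ∸ 1 → 1 ≤ a →
    (x : Point) →
    IsVertex n i a x ⇔
      Σ Subset (λ A → SubsetOfQ n i A × Antichain A ×
        x ≈[ n ] (λ k l → toℚ a * χ A k l))
proposition2p1 n i a _ _ _ 1≤a x =
  mk⇔ (vertex⇒indicator 1≤a) (indicator⇒vertex {n} {i} {a})
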